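{- Let $P_n$ denote the path on $n\ge 2$ vertices. Then $PC(P_n)=2$ if $n\in\{2,4\}$, and $PC(P_n)=3$ otherwise.
   Context: All graphs are finite, simple and undirected. A set $S\subseteq V(G)$ is a dominating set of $G$ if every vertex of $G$ is in $S$ or adjacent to a vertex of $S$. A paired dominating set of $G$ is a dominating set $S$ such that the induced subgraph $G[S]$ has a perfect matching. Two disjoint sets $V_1,V_2\subseteq V(G)$ form a paired coalition (are $pc$-partners) if neither $V_1$ nor $V_2$ is a paired dominating set of $G$ but $V_1\cup V_2$ is a paired dominating set of $G$. A paired coalition partition ($pc$-partition) of $G$ is a partition $\pi=\{V_1,\dots,V_k\}$ of $V(G)$ into nonempty sets such that no $V_i$ is a paired dominating set and every $V_i$ forms a paired coalition with some other $V_j\in\pi$. The paired coalition number $PC(G)$ is the maximum order $k$ of a $pc$-partition of $G$, and $PC(G)=0$ if $G$ has no $pc$-partition. -}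

module Defs where

open import Data.Nat using (ℕ; suc; _+_; _≤_)
open import Data.Fin using (Fin; toℕ)
open import Data.Product using (Σ; ∃; _×_)
open import Data.Sum using (_⊎_)
open import Relation.Nullary using (¬_)
open import Relation.Binary.PropositionalEquality using (_≡_; _≢_)

Adjacency : ℕ → Set₁
Adjacency n = Fin n → Fin n → Set

PathAdj : (n : ℕ) → Adjacency n
PathAdj n i j = (suc (toℕ i) ≡ toℕ j) ⊎ (suc (toℕ j) ≡ toℕ i)

VSet : ℕ → Set₁
VSet n = Fin n → Set

_∪_ : ∀ {n} → VSet n → VSet n → VSet n
(A ∪ B) v = A v ⊎ B v

module _ {n : ℕ} (Adj : Adjacency n) where

  Dominating : VSet n → Set
  Dominating S = ∀ v → S v ⊎ (∃ λ u → S u × Adj u v)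

  HasPerfectMatching : VSet n → Set
  HasPerfectMatching S =
    Σ (Fin n → Fin n) λ m →
      ∀ v → S v → S (m v) × (m v ≢ v) × (m (m v) ≡ v) × Adj v (m v)

  PairedDominating : VSet n → Set
  PairedDominating S = Dominating S × HasPerfectMatching S

  -- (disjointness is supplied by the partition in which this is used)
  PairedCoalition : VSet n → VSet n → Set
  PairedCoalition A B =
    ¬ PairedDominating A × ¬ PairedDominating B × PairedDominating (A ∪ B)

  Class : ∀ {k} → (Fin n → Fin k) → Fin k → VSet n
  Class f i v = f v ≡ i

  IsPCPartition : (k : ℕ) → (Fin n → Fin k) → Set
  IsPCPartition k f =
    (∀ i → ∃ λ v → f v ≡ i)
    × (∀ i → ¬ PairedDominating (Class f i))
    × (∀ i → ∃ λ j → (j ≢ i) × PairedCoalition (Class f i) (Class f j))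

  IsPCNumber : ℕ → Set
  IsPCNumber m =
    ((Σ (Fin n → Fin m) λ f → IsPCPartition m f)
      ⊎ ((m ≡ 0) × (∀ k (f : Fin n → Fin k) → ¬ IsPCPartition k f)))
    × (∀ k (f : Fin n → Fin k) → IsPCPartition k f → k ≤ m)

{-# OPTIONS --safe #-}
module Submission where

-- Vertex 1 of P_n (n ≥ 2) lies in every paired dominating set, so every class of a
-- pc-partition other than the class A of vertex 1 forms a coalition with A. In a graph of
-- maximum degree two, if A ∪ Y is paired dominating for three pairwise disjoint sets Y,
-- then A itself is: a vertex has at most two neighbours, so one of the three dominators
-- lies in A, and two of the three matchings agree on every vertex of A, so the majority
-- vote of the matchings is a perfect matching of A. Hence PC(P_n) ≤ 3. On P_4 the vertices
-- 1 and 2 are both forced; if they share the class A and there are three classes, then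
-- A ∪ {0} = {0, 1, 2} would be paired dominating, which it is not.
-- Conversely, putting two new vertices in front of a pc-partition of P_n whose vertices
-- 0 and 1 share a class gives a pc-partition of P_(n+2): a set containing both new
-- vertices and the old vertex 0 is paired dominating iff what remains is. Starting from
-- AABAC on P_5 and AABBCCAA on P_8 (A, B, C being the classes # 0, # 1, # 2), together
-- with BAC on P_3 and BACBAC on P_6, this gives order 3 for every n ∉ {2, 4}.

open import Defs
open import Data.Nat using (ℕ; zero; suc; _≤_; _+_; z≤n; s≤s)
import Data.Nat as ℕ
import Data.Nat.Properties as ℕ
open import Data.Fin using (Fin; zero; suc; toℕ; punchIn; _≟_; #_)
import Data.Fin.Properties as Fin
open import Data.Fin.Properties using (toℕ-injective; punchIn-injective; punchInᵢ≢i; injective⇒≤; all?; any?)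
open import Data.Bool using (Bool; _∧_; if_then_else_)
open import Data.Vec using ([]; _∷_; lookup)
open import Data.Product using (Σ; ∃; _×_; _,_; proj₁; proj₂)
import Data.Product as Product
open import Data.Sum using (_⊎_; inj₁; inj₂; [_,_])
import Data.Sum as Sum
open import Data.Empty using (⊥; ⊥-elim)
open import Function using (id; _∘_)
open import Relation.Nullary using (¬_; Dec; yes; no; contradiction)
open import Relation.Nullary.Decidable using (True; toWitness; isYes; ¬?; _×-dec_; _⊎-dec_; _→-dec_)
open import Relation.Unary using (Decidable)
open import Relation.Binary.Definitions using (Symmetric)
open import Relation.Binary.PropositionalEquality using (_≡_; _≢_; refl; sym; trans; cong; subst)

Disjoint : ∀ {n} → VSet n → VSet n → Set
Disjoint Y Z = ∀ v → Y v → Z v → ⊥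

module _ {n : ℕ} (Adj : Adjacency n) where

  IsPerfectMatching : (Fin n → Fin n) → VSet n → Set
  IsPerfectMatching m S = ∀ v → S v → S (m v) × (m v ≢ v) × (m (m v) ≡ v) × Adj v (m v)

  Forced : Fin n → Set₁
  Forced p = ∀ S → PairedDominating Adj S → S p

  Undominated : VSet n → Set
  Undominated S = ∃ λ v → ¬ S v × (∀ u → S u → ¬ Adj u v)

  HasIsolatedVertex : VSet n → Set
  HasIsolatedVertex S = ∃ λ v → S v × (∀ u → S u → ¬ Adj v u)

  AtMostTwoNeighbours : Set
  AtMostTwoNeighbours = ∀ {v x y z} → Adj v x → Adj v y → Adj v z → x ≡ y ⊎ x ≡ z ⊎ y ≡ z

module _ {n : ℕ} {Adj : Adjacency n} where

  undominated⇒¬pairedDominating : ∀ {S} → Undominated Adj S → ¬ PairedDominating Adj S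
  undominated⇒¬pairedDominating (v , v∉S , noDominator) (dom , _) with dom v
  ... | inj₁ v∈S = v∉S v∈S
  ... | inj₂ (u , u∈S , adj) = noDominator u u∈S adj

  isolated⇒¬pairedDominating : ∀ {S} → HasIsolatedVertex Adj S → ¬ PairedDominating Adj S
  isolated⇒¬pairedDominating (v , v∈S , noNeighbour) (_ , m , matching) with matching v v∈S
  ... | mv∈S , _ , _ , adj = noNeighbour (m v) mv∈S adj

  forcedClass-partner : ∀ {k f p} → IsPCPartition Adj k f → Forced Adj p →
                        ∀ i → i ≢ f p → PairedDominating Adj (Class Adj f i ∪ Class Adj f (f p))
  forcedClass-partner {f = f} (_ , _ , coalition) forced i i≢fp with coalition i
  ... | j , _ , _ , _ , pdᵢⱼ with forced _ pdᵢⱼ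
  ...   | inj₁ fp≡i = contradiction (sym fp≡i) i≢fp
  ...   | inj₂ fp≡j = subst (λ j → PairedDominating Adj (Class Adj f i ∪ Class Adj f j)) (sym fp≡j) pdᵢⱼ

  forcedClasses-cover : ∀ {k f p q} → IsPCPartition Adj k f → Forced Adj p → Forced Adj q →
                        f q ≢ f p → ∀ v → f v ≡ f p ⊎ f v ≡ f q
  forcedClasses-cover {f = f} {p} {q} pc forced-p forced-q fq≢fp v with f v ≟ f p | f v ≟ f q
  ... | yes fv≡fp | _ = inj₁ fv≡fp
  ... | no _ | yes fv≡fq = inj₂ fv≡fq
  ... | no fv≢fp | no fv≢fq with forced-q _ (forcedClass-partner pc forced-p (f v) fv≢fp)
  ...   | inj₁ fq≡fv = contradiction (sym fq≡fv) fv≢fq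
  ...   | inj₂ fq≡fp = contradiction fq≡fp fq≢fp

majority : ∀ {n} → Fin n → Fin n → Fin n → Fin n
majority x y z with x ≟ y
... | yes _ = x
... | no _ = z

data IsMajorityOf {n} (u x y z : Fin n) : Set where
  xy : x ≡ u → y ≡ u → IsMajorityOf u x y z
  xz : x ≡ u → z ≡ u → IsMajorityOf u x y z
  yz : y ≡ u → z ≡ u → IsMajorityOf u x y z

majority-correct : ∀ {n} {u x y z : Fin n} → IsMajorityOf u x y z → majority x y z ≡ u
majority-correct {x = x} {y} maj with x ≟ y | maj
... | yes _ | xy x≡u _ = x≡u
... | yes _ | xz x≡u _ = x≡u
... | yes x≡y | yz y≡u _ = trans x≡y y≡u
... | no x≢y | xy x≡u y≡u = contradiction (trans x≡u (sym y≡u)) x≢y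
... | no _ | xz _ z≡u = z≡u
... | no _ | yz _ z≡u = z≡u

module _ {n : ℕ} {Adj : Adjacency n} (adj-sym : Symmetric Adj) (deg≤2 : AtMostTwoNeighbours Adj) where

  majority-exists : ∀ {v x y z} → Adj v x → Adj v y → Adj v z → ∃ λ u → IsMajorityOf u x y z
  majority-exists {x = x} {y} ax ay az with deg≤2 ax ay az
  ... | inj₁ x≡y = x , xy refl (sym x≡y)
  ... | inj₂ (inj₁ x≡z) = x , xz refl (sym x≡z)
  ... | inj₂ (inj₂ y≡z) = y , yz refl (sym y≡z)

  dominated-from-union : ∀ {A Y} → PairedDominating Adj (Y ∪ A) → ∀ w →
                         A w ⊎ (∃ λ u → A u × Adj u w) ⊎ (∃ λ u → Y u × Adj w u)
  dominated-from-union (dom , m , matching) w with dom w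
  ... | inj₁ (inj₂ w∈A) = inj₁ w∈A
  ... | inj₂ (u , inj₂ u∈A , adj) = inj₂ (inj₁ (u , u∈A , adj))
  ... | inj₂ (u , inj₁ u∈Y , adj) = inj₂ (inj₂ (u , u∈Y , adj-sym adj))
  ... | inj₁ (inj₁ w∈Y) with matching w (inj₁ w∈Y)
  ...   | inj₂ mw∈A , _ , _ , adj = inj₂ (inj₁ (m w , mw∈A , adj-sym adj))
  ...   | inj₁ mw∈Y , _ , _ , adj = inj₂ (inj₂ (m w , mw∈Y , adj))

  commonPartner : ∀ {A Y Z m m′ v u} → Disjoint Y Z →
                  IsPerfectMatching Adj m (Y ∪ A) → IsPerfectMatching Adj m′ (Z ∪ A) →
                  A v → m v ≡ u → m′ v ≡ u → A u × u ≢ v × Adj v u × m u ≡ v × m′ u ≡ v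
  commonPartner {A} {Y} {Z} {m} {m′} {v} disjoint matching matching′ v∈A refl m′v≡mv
    with matching v (inj₂ v∈A) | matching′ v (inj₂ v∈A)
  ... | mv∈ , mv≢v , mmv≡v , adj | m′v∈ , _ , m′m′v≡v , _ =
    inA mv∈ (subst (Z ∪ A) m′v≡mv m′v∈) , mv≢v , adj , mmv≡v , trans (cong m′ (sym m′v≡mv)) m′m′v≡v
    where
    inA : ∀ {w} → (Y ∪ A) w → (Z ∪ A) w → A w
    inA (inj₂ w∈A) _ = w∈A
    inA (inj₁ _) (inj₂ w∈A) = w∈A
    inA (inj₁ w∈Y) (inj₁ w∈Z) = ⊥-elim (disjoint _ w∈Y w∈Z)

  pairedDominating-fromThreeUnions :
    ∀ {A Y₁ Y₂ Y₃} → Disjoint Y₁ Y₂ → Disjoint Y₁ Y₃ → Disjoint Y₂ Y₃ →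
    PairedDominating Adj (Y₁ ∪ A) → PairedDominating Adj (Y₂ ∪ A) → PairedDominating Adj (Y₃ ∪ A) →
    PairedDominating Adj A
  pairedDominating-fromThreeUnions {A} d₁₂ d₁₃ d₂₃ pd₁@(_ , m₁ , pm₁) pd₂@(_ , m₂ , pm₂) pd₃@(_ , m₃ , pm₃) =
    dominating , M , matching
    where
    dominating : Dominating Adj A
    dominating w with dominated-from-union pd₁ w | dominated-from-union pd₂ w | dominated-from-union pd₃ w
    ... | inj₁ w∈A | _ | _ = inj₁ w∈A
    ... | inj₂ (inj₁ dominator) | _ | _ = inj₂ dominator
    ... | _ | inj₁ w∈A | _ = inj₁ w∈A
    ... | _ | inj₂ (inj₁ dominator) | _ = inj₂ dominator
    ... | _ | _ | inj₁ w∈A = inj₁ w∈A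
    ... | _ | _ | inj₂ (inj₁ dominator) = inj₂ dominator
    ... | inj₂ (inj₂ (u₁ , y₁ , a₁)) | inj₂ (inj₂ (u₂ , y₂ , a₂)) | inj₂ (inj₂ (u₃ , y₃ , a₃)) with deg≤2 a₁ a₂ a₃
    ...   | inj₁ refl = ⊥-elim (d₁₂ u₁ y₁ y₂)
    ...   | inj₂ (inj₁ refl) = ⊥-elim (d₁₃ u₁ y₁ y₃)
    ...   | inj₂ (inj₂ refl) = ⊥-elim (d₂₃ u₂ y₂ y₃)

    M : Fin n → Fin n
    M v = majority (m₁ v) (m₂ v) (m₃ v)

    majorityPartner : ∀ {v u} → A v → IsMajorityOf u (m₁ v) (m₂ v) (m₃ v) → A u × u ≢ v × M u ≡ v × Adj v u
    majorityPartner v∈A (xy e₁ e₂) with commonPartner d₁₂ pm₁ pm₂ v∈A e₁ e₂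
    ... | u∈A , u≢v , adj , f₁ , f₂ = u∈A , u≢v , majority-correct (xy f₁ f₂) , adj
    majorityPartner v∈A (xz e₁ e₃) with commonPartner d₁₃ pm₁ pm₃ v∈A e₁ e₃
    ... | u∈A , u≢v , adj , f₁ , f₃ = u∈A , u≢v , majority-correct (xz f₁ f₃) , adj
    majorityPartner v∈A (yz e₂ e₃) with commonPartner d₂₃ pm₂ pm₃ v∈A e₂ e₃
    ... | u∈A , u≢v , adj , f₂ , f₃ = u∈A , u≢v , majority-correct {x = m₁ _} (yz f₂ f₃) , adj

    matching : IsPerfectMatching Adj M A
    matching v v∈A with pm₁ v (inj₂ v∈A) | pm₂ v (inj₂ v∈A) | pm₃ v (inj₂ v∈A)
    ... | _ , _ , _ , a₁ | _ , _ , _ , a₂ | _ , _ , _ , a₃ with majority-exists a₁ a₂ a₃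
    ...   | u , maj = subst (λ w → A w × w ≢ v × M w ≡ v × Adj v w) (sym (majority-correct maj))
                            (majorityPartner v∈A maj)

  pcPartition-≤3 : ∀ {k f p} → Forced Adj p → IsPCPartition Adj k f → k ≤ 3
  pcPartition-≤3 {k = 0} _ _ = z≤n
  pcPartition-≤3 {k = 1} _ _ = s≤s z≤n
  pcPartition-≤3 {k = 2} _ _ = s≤s (s≤s z≤n)
  pcPartition-≤3 {k = 3} _ _ = s≤s (s≤s (s≤s z≤n))
  pcPartition-≤3 {k = suc (suc (suc (suc k)))} {f} {p} forced pc@(_ , notPD , _) =
    contradiction (pairedDominating-fromThreeUnions (disjoint (λ ())) (disjoint (λ ())) (disjoint (λ ()))
                    (partner zero) (partner (suc zero)) (partner (suc (suc zero))))
                  (notPD (f p))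
    where
    other : Fin (3 + k) → Fin (4 + k)
    other = punchIn (f p)

    partner : ∀ t → PairedDominating Adj (Class Adj f (other t) ∪ Class Adj f (f p))
    partner t = forcedClass-partner pc forced (other t) (punchInᵢ≢i (f p) t)

    disjoint : ∀ {s t} → s ≢ t → Disjoint (Class Adj f (other s)) (Class Adj f (other t))
    disjoint {s} {t} s≢t _ fv≡s fv≡t = s≢t (punchIn-injective (f p) s t (trans (sym fv≡s) fv≡t))

pathAdj-suc : ∀ {n} {u v : Fin n} → PathAdj n u v → PathAdj (suc n) (suc u) (suc v)
pathAdj-suc = Sum.map (cong suc) (cong suc)

pathAdj-suc⁻¹ : ∀ {n} {u v : Fin n} → PathAdj (suc n) (suc u) (suc v) → PathAdj n u v
pathAdj-suc⁻¹ = Sum.map ℕ.suc-injective ℕ.suc-injective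

pathAdj-sym : ∀ {n} → Symmetric (PathAdj n)
pathAdj-sym = Sum.swap

private
  rightNeighbour-unique : ∀ {n} {v x y : Fin n} → suc (toℕ v) ≡ toℕ x → suc (toℕ v) ≡ toℕ y → x ≡ y
  rightNeighbour-unique a b = toℕ-injective (trans (sym a) b)

  leftNeighbour-unique : ∀ {n} {v x y : Fin n} → suc (toℕ x) ≡ toℕ v → suc (toℕ y) ≡ toℕ v → x ≡ y
  leftNeighbour-unique a b = toℕ-injective (ℕ.suc-injective (trans a (sym b)))

pathAdj-atMostTwoNeighbours : ∀ {n} → AtMostTwoNeighbours (PathAdj n)
pathAdj-atMostTwoNeighbours (inj₁ a) (inj₁ b) _ = inj₁ (rightNeighbour-unique a b)
pathAdj-atMostTwoNeighbours (inj₂ a) (inj₂ b) _ = inj₁ (leftNeighbour-unique a b)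
pathAdj-atMostTwoNeighbours (inj₁ a) (inj₂ _) (inj₁ c) = inj₂ (inj₁ (rightNeighbour-unique a c))
pathAdj-atMostTwoNeighbours (inj₁ _) (inj₂ b) (inj₂ c) = inj₂ (inj₂ (leftNeighbour-unique b c))
pathAdj-atMostTwoNeighbours (inj₂ _) (inj₁ b) (inj₁ c) = inj₂ (inj₂ (rightNeighbour-unique b c))
pathAdj-atMostTwoNeighbours (inj₂ a) (inj₁ _) (inj₂ c) = inj₂ (inj₁ (leftNeighbour-unique a c))

pathAdj-zero : ∀ {n} {u : Fin (2 + n)} → PathAdj (2 + n) zero u → u ≡ suc zero
pathAdj-zero {u = zero} (inj₁ ())
pathAdj-zero {u = zero} (inj₂ ())
pathAdj-zero {u = suc zero} _ = refl
pathAdj-zero {u = suc (suc _)} (inj₁ ())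
pathAdj-zero {u = suc (suc _)} (inj₂ ())

vertex1-forced : ∀ {n} → Forced (PathAdj (2 + n)) (suc zero)
vertex1-forced S (dom , m , matching) with dom zero
... | inj₂ (u , u∈S , adj) = subst S (pathAdj-zero (pathAdj-sym adj)) u∈S
... | inj₁ 0∈S with matching zero 0∈S
...   | m0∈S , _ , _ , adj = subst S (pathAdj-zero adj) m0∈S

tail₂ : ∀ {n} → VSet (2 + n) → VSet n
tail₂ T v = T (suc (suc v))

withEdge₀₁ : ∀ {n} → (Fin n → Fin n) → Fin (2 + n) → Fin (2 + n)
withEdge₀₁ m zero = suc zero
withEdge₀₁ m (suc zero) = zero
withEdge₀₁ m (suc (suc v)) = suc (suc (m v))

prependEdge-pairedDominating : ∀ {n} {T : VSet (2 + n)} → T zero → T (suc zero) →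
  PairedDominating (PathAdj n) (tail₂ T) → PairedDominating (PathAdj (2 + n)) T
prependEdge-pairedDominating {n} {T} t₀ t₁ (dom , m , matching) = dom′ , withEdge₀₁ m , matching′
  where
  dom′ : Dominating (PathAdj (2 + n)) T
  dom′ zero = inj₁ t₀
  dom′ (suc zero) = inj₁ t₁
  dom′ (suc (suc v)) with dom v
  ... | inj₁ v∈S = inj₁ v∈S
  ... | inj₂ (u , u∈S , adj) = inj₂ (suc (suc u) , u∈S , pathAdj-suc (pathAdj-suc adj))

  matching′ : IsPerfectMatching (PathAdj (2 + n)) (withEdge₀₁ m) T
  matching′ zero _ = t₁ , (λ ()) , refl , inj₁ refl
  matching′ (suc zero) _ = t₀ , (λ ()) , refl , inj₂ refl
  matching′ (suc (suc v)) v∈S with matching v v∈S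
  ... | mv∈S , mv≢v , mmv≡v , adj =
    mv∈S , mv≢v ∘ Fin.suc-injective ∘ Fin.suc-injective , cong (λ w → suc (suc w)) mmv≡v , pathAdj-suc (pathAdj-suc adj)

dropEdge-pairedDominating : ∀ {n} {T : VSet (3 + n)} → T zero → T (suc (suc zero)) →
  PairedDominating (PathAdj (3 + n)) T → PairedDominating (PathAdj (suc n)) (tail₂ T)
dropEdge-pairedDominating {n} {T} t₀ t₂ (dom , m , matching) = dom′ , m′ , matching′
  where
  dom′ : Dominating (PathAdj (suc n)) (tail₂ T)
  dom′ zero = inj₁ t₂
  dom′ (suc v) with dom (suc (suc (suc v)))
  ... | inj₁ v∈S = inj₁ v∈S
  ... | inj₂ (zero , _ , inj₁ ())
  ... | inj₂ (zero , _ , inj₂ ())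
  ... | inj₂ (suc zero , _ , inj₁ ())
  ... | inj₂ (suc zero , _ , inj₂ ())
  ... | inj₂ (suc (suc u) , u∈S , adj) = inj₂ (u , u∈S , pathAdj-suc⁻¹ (pathAdj-suc⁻¹ adj))

  m0≡1 : m zero ≡ suc zero
  m0≡1 = pathAdj-zero (proj₂ (proj₂ (proj₂ (matching zero t₀))))

  m1≡0 : m (suc zero) ≡ zero
  m1≡0 = trans (cong m (sym m0≡1)) (proj₁ (proj₂ (proj₂ (matching zero t₀))))

  partner-beyondEdge : ∀ v → T (suc (suc v)) → ∃ λ u → m (suc (suc v)) ≡ suc (suc u)
  partner-beyondEdge v v∈S with m (suc (suc v)) | matching (suc (suc v)) v∈S
  ... | zero | _ , _ , mmv≡v , _ with () ← trans (sym m0≡1) mmv≡v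
  ... | suc zero | _ , _ , mmv≡v , _ with () ← trans (sym m1≡0) mmv≡v
  ... | suc (suc u) | _ = u , refl

  lower₂ : Fin (suc n) → Fin (3 + n) → Fin (suc n)
  lower₂ _ (suc (suc u)) = u
  lower₂ default _ = default

  m′ : Fin (suc n) → Fin (suc n)
  m′ v = lower₂ v (m (suc (suc v)))

  matching′ : IsPerfectMatching (PathAdj (suc n)) m′ (tail₂ T)
  matching′ v v∈S with partner-beyondEdge v v∈S
  ... | u , mv≡u with matching (suc (suc v)) v∈S
  ...   | mv∈S , mv≢v , mmv≡v , adj =
    subst (λ w → T (suc (suc w)) × w ≢ v × m′ w ≡ v × PathAdj (suc n) v w) (sym (cong (lower₂ v) mv≡u))
      ( subst T mv≡u mv∈S
      , (λ u≡v → mv≢v (trans mv≡u (cong (λ w → suc (suc w)) u≡v)))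
      , cong (lower₂ u) (trans (cong m (sym mv≡u)) mmv≡v)
      , pathAdj-suc⁻¹ (pathAdj-suc⁻¹ (subst (PathAdj (3 + n) (suc (suc v))) mv≡u adj)) )

prepend₂ : ∀ {n k} → (Fin (2 + n) → Fin k) → Fin (4 + n) → Fin k
prepend₂ f zero = f zero
prepend₂ f (suc zero) = f zero
prepend₂ f (suc (suc v)) = f v

prepend₂-isPCPartition : ∀ {n k} {f : Fin (2 + n) → Fin k} →
  IsPCPartition (PathAdj (2 + n)) k f → f zero ≡ f (suc zero) →
  IsPCPartition (PathAdj (4 + n)) k (prepend₂ f)
prepend₂-isPCPartition {n} {k} {f} (nonempty , notPD , coalition) f₀≡f₁ = nonempty′ , notPD′ , coalition′
  where
  Class′ : Fin k → VSet (4 + n)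
  Class′ = Class (PathAdj (4 + n)) (prepend₂ f)

  nonempty′ : ∀ i → ∃ λ v → prepend₂ f v ≡ i
  nonempty′ i = Product.map (λ v → suc (suc v)) id (nonempty i)

  notPD′ : ∀ i → ¬ PairedDominating (PathAdj (4 + n)) (Class′ i)
  notPD′ i pd with f zero ≟ i
  ... | yes f₀≡i = notPD i (dropEdge-pairedDominating f₀≡i f₀≡i pd)
  ... | no f₀≢i = f₀≢i (vertex1-forced _ pd)

  coalition′ : ∀ i → ∃ λ j → j ≢ i × PairedCoalition (PathAdj (4 + n)) (Class′ i) (Class′ j)
  coalition′ i with coalition i
  ... | j , j≢i , _ , _ , pdᵢⱼ = j , j≢i , notPD′ i , notPD′ j , prependEdge-pairedDominating f₀∈ f₀∈ pdᵢⱼ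
    where
    f₀∈ : f zero ≡ i ⊎ f zero ≡ j
    f₀∈ = Sum.map (trans f₀≡f₁) (trans f₀≡f₁) (vertex1-forced _ pdᵢⱼ)

pathPCPartition-≤3 : ∀ {n k f} → 2 ≤ n → IsPCPartition (PathAdj n) k f → k ≤ 3
pathPCPartition-≤3 (s≤s (s≤s _)) =
  pcPartition-≤3 pathAdj-sym pathAdj-atMostTwoNeighbours vertex1-forced

pairCover⇒≤2 : ∀ {n k} {f : Fin n → Fin k} {a b : Fin k} →
               (∀ i → ∃ λ v → f v ≡ i) → (∀ v → f v ≡ a ⊎ f v ≡ b) → k ≤ 2
pairCover⇒≤2 {f = f} {a} {b} surjective cover =
  injective⇒≤ (λ {i} {j} → side-injective (covered i) (covered j))
  where
  covered : ∀ i → i ≡ a ⊎ i ≡ b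
  covered i = subst (λ x → x ≡ a ⊎ x ≡ b) (proj₂ (surjective i)) (cover (proj₁ (surjective i)))

  side : ∀ {i} → i ≡ a ⊎ i ≡ b → Fin 2
  side (inj₁ _) = zero
  side (inj₂ _) = suc zero

  side-injective : ∀ {i j} (cᵢ : i ≡ a ⊎ i ≡ b) (cⱼ : j ≡ a ⊎ j ≡ b) → side cᵢ ≡ side cⱼ → i ≡ j
  side-injective (inj₁ refl) (inj₁ refl) _ = refl
  side-injective (inj₂ refl) (inj₂ refl) _ = refl
  side-injective (inj₁ _) (inj₂ _) ()
  side-injective (inj₂ _) (inj₁ _) ()

P₂-pcPartition-≤2 : ∀ {k f} → IsPCPartition (PathAdj 2) k f → k ≤ 2
P₂-pcPartition-≤2 {f = f} (surjective , _) = pairCover⇒≤2 surjective cover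
  where
  cover : ∀ v → f v ≡ f zero ⊎ f v ≡ f (suc zero)
  cover zero = inj₁ refl
  cover (suc zero) = inj₂ refl

P₄-neighbour-of-3 : ∀ {u} → PathAdj 4 (# 3) u → u ≡ # 2
P₄-neighbour-of-3 {zero} (inj₁ ())
P₄-neighbour-of-3 {zero} (inj₂ ())
P₄-neighbour-of-3 {suc zero} (inj₁ ())
P₄-neighbour-of-3 {suc zero} (inj₂ ())
P₄-neighbour-of-3 {suc (suc zero)} _ = refl
P₄-neighbour-of-3 {suc (suc (suc zero))} (inj₁ ())
P₄-neighbour-of-3 {suc (suc (suc zero))} (inj₂ ())

P₄-vertex2-forced : Forced (PathAdj 4) (# 2)
P₄-vertex2-forced S (dom , m , matching) with dom (# 3)
... | inj₂ (u , u∈S , adj) = subst S (P₄-neighbour-of-3 (pathAdj-sym adj)) u∈S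
... | inj₁ 3∈S with matching (# 3) 3∈S
...   | m3∈S , _ , _ , adj = subst S (P₄-neighbour-of-3 adj) m3∈S

fourCases : ∀ {P : Fin 4 → Set} → P (# 0) → P (# 1) → P (# 2) → P (# 3) → ∀ v → P v
fourCases p₀ p₁ p₂ p₃ = Fin.∀-cons p₀ (Fin.∀-cons p₁ (Fin.∀-cons p₂ (Fin.∀-cons p₃ λ ())))

P₄-pcPartition-≤2 : ∀ {k f} → IsPCPartition (PathAdj 4) k f → k ≤ 2
P₄-pcPartition-≤2 {f = f} pc@(surjective , _) with f (# 2) ≟ f (# 1)
... | no f₂≢f₁ = pairCover⇒≤2 surjective (forcedClasses-cover pc vertex1-forced P₄-vertex2-forced f₂≢f₁)
... | yes f₂≡f₁ with f (# 0) ≟ f (# 1) | f (# 3) ≟ f (# 1) | f (# 3) ≟ f (# 0)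
...   | yes f₀≡f₁ | _ | _ = pairCover⇒≤2 surjective (fourCases (inj₁ f₀≡f₁) (inj₁ refl) (inj₁ f₂≡f₁) (inj₂ refl))
...   | no _ | yes f₃≡f₁ | _ = pairCover⇒≤2 surjective (fourCases (inj₁ refl) (inj₂ refl) (inj₂ f₂≡f₁) (inj₂ f₃≡f₁))
...   | no _ | no _ | yes f₃≡f₀ = pairCover⇒≤2 surjective (fourCases (inj₁ refl) (inj₂ refl) (inj₂ f₂≡f₁) (inj₁ f₃≡f₀))
...   | no f₀≢f₁ | no f₃≢f₁ | no f₃≢f₀ =
    -- dropping the edge 01 from the paired dominating set {0, 1, 2} leaves one of P_2 without vertex 3
    ⊥-elim ([ f₃≢f₀ , f₃≢f₁ ] (vertex1-forced _ (dropEdge-pairedDominating (inj₁ refl) (inj₂ f₂≡f₁)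
                                                   (forcedClass-partner pc vertex1-forced (f (# 0)) f₀≢f₁))))

greedyMatching : ∀ {n} → (Fin n → Bool) → Fin n → Fin n
greedyMatching {suc (suc n)} s =
  if s zero ∧ s (suc zero)
    then withEdge₀₁ (greedyMatching (λ v → s (suc (suc v))))
    else skip₀ (greedyMatching (λ v → s (suc v)))
  where
  skip₀ : (Fin (suc n) → Fin (suc n)) → Fin (2 + n) → Fin (2 + n)
  skip₀ m zero = zero
  skip₀ m (suc v) = suc (m v)
greedyMatching _ = id

pathAdj? : ∀ {n} (u v : Fin n) → Dec (PathAdj n u v)
pathAdj? u v = (suc (toℕ u) ℕ.≟ toℕ v) ⊎-dec (suc (toℕ v) ℕ.≟ toℕ u)

module _ {n : ℕ} {S : VSet n} (S? : Decidable S) where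

  dominating? : Dec (Dominating (PathAdj n) S)
  dominating? = all? λ v → S? v ⊎-dec any? λ u → S? u ×-dec pathAdj? u v

  isPerfectMatching? : ∀ m → Dec (IsPerfectMatching (PathAdj n) m S)
  isPerfectMatching? m =
    all? λ v → S? v →-dec (S? (m v) ×-dec ¬? (m v ≟ v) ×-dec m (m v) ≟ v ×-dec pathAdj? v (m v))

  undominated? : Dec (Undominated (PathAdj n) S)
  undominated? = any? λ v → ¬? (S? v) ×-dec all? λ u → S? u →-dec ¬? (pathAdj? u v)

  hasIsolatedVertex? : Dec (HasIsolatedVertex (PathAdj n) S)
  hasIsolatedVertex? = any? λ v → S? v ×-dec all? λ u → S? u →-dec ¬? (pathAdj? v u)

-- A decidable sufficient condition, so that the base partitions are checked by evaluation.
module _ {n k : ℕ} (f : Fin n → Fin k) where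

  private
    C : Fin k → VSet n
    C = Class (PathAdj n) f

    C? : ∀ i → Decidable (C i)
    C? i v = f v ≟ i

    C∪C? : ∀ i j → Decidable (C i ∪ C j)
    C∪C? i j v = C? i v ⊎-dec C? j v

  CertifiedPCPartition : Set
  CertifiedPCPartition =
    (∀ i → ∃ λ v → f v ≡ i)
    × (∀ i → Undominated (PathAdj n) (C i) ⊎ HasIsolatedVertex (PathAdj n) (C i))
    × (∀ i → ∃ λ j → j ≢ i × Dominating (PathAdj n) (C i ∪ C j)
                          × IsPerfectMatching (PathAdj n) (greedyMatching (isYes ∘ C∪C? i j)) (C i ∪ C j))

  certifiedPCPartition? : Dec CertifiedPCPartition
  certifiedPCPartition? =
    all? (λ i → any? λ v → C? i v)
    ×-dec all? (λ i → undominated? (C? i) ⊎-dec hasIsolatedVertex? (C? i))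
    ×-dec all? (λ i → any? λ j → ¬? (j ≟ i) ×-dec dominating? (C∪C? i j)
                                   ×-dec isPerfectMatching? (C∪C? i j) (greedyMatching (isYes ∘ C∪C? i j)))

  certified⇒isPCPartition : CertifiedPCPartition → IsPCPartition (PathAdj n) k f
  certified⇒isPCPartition (nonempty , obstructions , coalitions) = nonempty , notPD , coalition
    where
    notPD : ∀ i → ¬ PairedDominating (PathAdj n) (C i)
    notPD i = [ undominated⇒¬pairedDominating , isolated⇒¬pairedDominating ] (obstructions i)

    coalition : ∀ i → ∃ λ j → j ≢ i × PairedCoalition (PathAdj n) (C i) (C j)
    coalition i with coalitions i
    ... | j , j≢i , dom , matching = j , j≢i , notPD i , notPD j , dom , _ , matching

certifiedPCPartition : ∀ {n k} (f : Fin n → Fin k) → {True (certifiedPCPartition? f)} → IsPCPartition (PathAdj n) k f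
certifiedPCPartition f {certificate} = certified⇒isPCPartition f (toWitness certificate)

pcPartition-P₂ : IsPCPartition (PathAdj 2) 2 (lookup (# 0 ∷ # 1 ∷ []))
pcPartition-P₂ = certifiedPCPartition _

pcPartition-P₃ : IsPCPartition (PathAdj 3) 3 (lookup (# 1 ∷ # 0 ∷ # 2 ∷ []))
pcPartition-P₃ = certifiedPCPartition _

pcPartition-P₄ : IsPCPartition (PathAdj 4) 2 (lookup (# 0 ∷ # 0 ∷ # 1 ∷ # 1 ∷ []))
pcPartition-P₄ = certifiedPCPartition _

pcPartition-P₅ : IsPCPartition (PathAdj 5) 3 (lookup (# 0 ∷ # 0 ∷ # 1 ∷ # 0 ∷ # 2 ∷ []))
pcPartition-P₅ = certifiedPCPartition _

pcPartition-P₆ : IsPCPartition (PathAdj 6) 3 (lookup (# 1 ∷ # 0 ∷ # 2 ∷ # 1 ∷ # 0 ∷ # 2 ∷ []))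
pcPartition-P₆ = certifiedPCPartition _

pcPartition-P₈ : IsPCPartition (PathAdj 8) 3 (lookup (# 0 ∷ # 0 ∷ # 1 ∷ # 1 ∷ # 2 ∷ # 2 ∷ # 0 ∷ # 0 ∷ []))
pcPartition-P₈ = certifiedPCPartition _

PCPartition₀₁ : ℕ → ℕ → Set
PCPartition₀₁ k n = Σ (Fin (2 + n) → Fin k) λ f → IsPCPartition (PathAdj (2 + n)) k f × f zero ≡ f (suc zero)

prepend₂-pcPartition₀₁ : ∀ {k n} → PCPartition₀₁ k n → PCPartition₀₁ k (2 + n)
prepend₂-pcPartition₀₁ (f , pc , f₀≡f₁) = prepend₂ f , prepend₂-isPCPartition pc f₀≡f₁ , refl

pcPartition₀₁-from-P₇ : ∀ m → PCPartition₀₁ 3 (5 + m)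
pcPartition₀₁-from-P₇ zero = prepend₂-pcPartition₀₁ (_ , pcPartition-P₅ , refl)
pcPartition₀₁-from-P₇ (suc zero) = _ , pcPartition-P₈ , refl
pcPartition₀₁-from-P₇ (suc (suc m)) = prepend₂-pcPartition₀₁ (pcPartition₀₁-from-P₇ m)

pathPCPartition-order3 : ∀ n → 2 ≤ n → n ≢ 2 → n ≢ 4 → Σ (Fin n → Fin 3) (IsPCPartition (PathAdj n) 3)
pathPCPartition-order3 0 () _ _
pathPCPartition-order3 1 (s≤s ()) _ _
pathPCPartition-order3 2 _ n≢2 _ = contradiction refl n≢2
pathPCPartition-order3 3 _ _ _ = _ , pcPartition-P₃
pathPCPartition-order3 4 _ _ n≢4 = contradiction refl n≢4
pathPCPartition-order3 5 _ _ _ = _ , pcPartition-P₅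
pathPCPartition-order3 6 _ _ _ = _ , pcPartition-P₆
pathPCPartition-order3 (suc (suc (suc (suc (suc (suc (suc m))))))) _ _ _ =
  Product.map₂ proj₁ (pcPartition₀₁-from-P₇ m)

pcNumber-order2 : ∀ n → n ≡ 2 ⊎ n ≡ 4 → IsPCNumber (PathAdj n) 2
pcNumber-order2 .2 (inj₁ refl) = inj₁ (_ , pcPartition-P₂) , λ _ _ → P₂-pcPartition-≤2
pcNumber-order2 .4 (inj₂ refl) = inj₁ (_ , pcPartition-P₄) , λ _ _ → P₄-pcPartition-≤2

mainTheorem1 : (n : ℕ) → 2 ≤ n →
    ((n ≡ 2 ⊎ n ≡ 4) → IsPCNumber (PathAdj n) 2)
    × ((n ≢ 2 × n ≢ 4) → IsPCNumber (PathAdj n) 3)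
mainTheorem1 n 2≤n =
  pcNumber-order2 n ,
  λ (n≢2 , n≢4) → inj₁ (pathPCPartition-order3 n 2≤n n≢2 n≢4) , λ _ _ → pathPCPartition-≤3 2≤n
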